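{- For any strings $S$ and $T$ over a finite alphabet, \[ \max\{\delta(S),\delta(T)\} \le \delta(S,T) \le \delta(S)+\delta(T). \]
   Context: For a string $S$ of length $n$ and an integer $k\ge 1$, let $D_k(S)=\{S[i..i+k-1] : 1\le i\le n-k+1\}$ be the set of distinct length-$k$ substrings of $S$ (empty if $k>n$), and $d_k(S)=|D_k(S)|$. The normalized substring complexity is $\delta(S)=\max_{k\ge 1} d_k(S)/k$. For two strings $S,T$ define $\delta(S,T)=\max_{k\ge1} |D_k(S)\cup D_k(T)|/k$. -}

module Defs where

open import Data.Nat using (ℕ; zero; suc; _∸_; _⊔_)
open import Data.Fin using (Fin)
open import Data.Fin.Properties using () renaming (_≟_ to _≟ᶠ_)
open import Data.List using (List; length; map; take; drop; upTo; foldr; deduplicate; _++_)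
open import Data.List.Properties using (≡-dec)
open import Data.Integer using (+_)
open import Data.Rational using (ℚ; 0ℚ; _/_) renaming (_⊔_ to _⊔ℚ_)

Str : ℕ → Set
Str σ = List (Fin σ)

_≟ˢ_ : ∀ {σ} (u v : Str σ) → _
_≟ˢ_ = ≡-dec _≟ᶠ_

-- The list of all length-k windows S[i..i+k-1], 0 ≤ i ≤ n-k (empty if k > n).
windows : ∀ {σ} → ℕ → Str σ → List (Str σ)
windows k S = map (λ i → take k (drop i S)) (upTo (suc (length S) ∸ k))

D : ∀ {σ} → ℕ → Str σ → List (Str σ)
D k S = deduplicate _≟ˢ_ (windows k S)

d : ∀ {σ} → ℕ → Str σ → ℕ
d k S = length (D k S)

-- |D_k(S) ∪ D_k(T)|
d₂ : ∀ {σ} → ℕ → Str σ → Str σ → ℕ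
d₂ k S T = length (deduplicate _≟ˢ_ (windows k S ++ windows k T))

-- maximum of a list of rationals (0 for the empty list; all values are ≥ 0)
maxℚ : List ℚ → ℚ
maxℚ = foldr _⊔ℚ_ 0ℚ

-- δ(S) = max_{k ≥ 1} d_k(S)/k.  For k > |S|, d_k(S) = 0, so the max is
-- attained over k ∈ {1..|S|} (and is 0 when S is empty).
δ : ∀ {σ} → Str σ → ℚ
δ S = maxℚ (map (λ i → (+ d (suc i) S) / suc i) (upTo (length S)))

δ₂ : ∀ {σ} → Str σ → Str σ → ℚ
δ₂ S T = maxℚ (map (λ i → (+ d₂ (suc i) S T) / suc i) (upTo (length S ⊔ length T)))

{-# OPTIONS --safe #-}
-- For every k, D_k(S) and D_k(T) are contained in D_k(S) ∪ D_k(T), which has at most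
-- d_k(S) + d_k(T) elements; dividing by k and passing to maxima gives both bounds.  The
-- maxima in δ range only over k ≤ |S|, but they still dominate every d_k(S)/k because
-- d_k(S) = 0 for k > |S|.
module Submission where

open import Defs
open import Data.Nat using (ℕ)
open import Data.Product using (_×_)
open import Data.Rational using (_≤_; _+_; _⊔_)

open import Data.Nat as ℕ using (suc; z≤n; s≤s)
import Data.Nat.Properties as ℕ
open import Data.Product using (_,_)
open import Data.Sum using (inj₁; inj₂)
open import Data.Empty using (⊥-elim)
open import Data.List using (List; []; _∷_; length; map; upTo; deduplicate; _++_)
open import Data.List.Properties using (length-++)
open import Data.List.Membership.Propositional using (_∈_)
open import Data.List.Membership.Propositional.Properties
  using (∈-∃++; ∈-++⁺ˡ; ∈-++⁺ʳ; ∈-++⁻; ∈-deduplicate⁻; ∈-deduplicate⁺; ∈-upTo⁺; ∈-map⁺)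
open import Data.List.Relation.Binary.Subset.Propositional using (_⊆_)
open import Data.List.Relation.Binary.Subset.Propositional.Properties
  using (xs⊆xs++ys; xs⊆ys++xs; ++⁺)
open import Data.List.Relation.Unary.Any using (here; there)
open import Data.List.Relation.Unary.All as All using (All; []; _∷_)
import Data.List.Relation.Unary.All.Properties as All
open import Data.List.Relation.Unary.Unique.Propositional using (Unique; _∷_)
open import Data.List.Relation.Unary.Unique.DecPropositional.Properties using (deduplicate-!)
open import Relation.Binary.Definitions using (DecidableEquality)
open import Relation.Binary.PropositionalEquality
  using (_≡_; _≢_; refl; sym; trans; cong; cong₂; subst; module ≡-Reasoning)
open import Relation.Nullary using (yes; no)
open import Data.Integer as ℤ using (+_)
import Data.Integer.Properties as ℤ
open import Data.Rational as ℚ using (ℚ; 0ℚ; toℚᵘ; _/_)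
import Data.Rational.Properties as ℚ
open import Data.Rational.Unnormalised as ℚᵘ using (mkℚᵘ; *≡*; *≤*)
import Data.Rational.Unnormalised.Properties as ℚᵘ

module _ {a} {A : Set a} where

  ∈-++-∷⁻ : ∀ {w u : A} as {bs} → w ∈ as ++ u ∷ bs → w ≢ u → w ∈ as ++ bs
  ∈-++-∷⁻ as p w≢u with ∈-++⁻ as p
  ... | inj₁ q           = ∈-++⁺ˡ q
  ... | inj₂ (here refl) = ⊥-elim (w≢u refl)
  ... | inj₂ (there q)   = ∈-++⁺ʳ as q

  Unique-⊆⇒length-≤ : ∀ {xs ys : List A} → Unique xs → xs ⊆ ys → length xs ℕ.≤ length ys
  Unique-⊆⇒length-≤ {[]}     _            _     = z≤n
  Unique-⊆⇒length-≤ {x ∷ xs} (x∉xs ∷ !xs) xs⊆ys with ∈-∃++ (xs⊆ys (here refl))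
  ... | as , bs , refl = subst (suc (length xs) ℕ.≤_) (sym length-split)
          (s≤s (Unique-⊆⇒length-≤ !xs xs⊆as++bs))
    where
    xs⊆as++bs : xs ⊆ as ++ bs
    xs⊆as++bs p = ∈-++-∷⁻ as (xs⊆ys (there p)) (λ e → All.lookup x∉xs p (sym e))

    length-split : length (as ++ x ∷ bs) ≡ suc (length (as ++ bs))
    length-split = begin
      length (as ++ x ∷ bs)          ≡⟨ length-++ as ⟩
      length as ℕ.+ suc (length bs)  ≡⟨ ℕ.+-suc (length as) (length bs) ⟩
      suc (length as ℕ.+ length bs)  ≡⟨ cong suc (length-++ as) ⟨
      suc (length (as ++ bs))        ∎
      where open ≡-Reasoning

module _ {a} {A : Set a} (_≟_ : DecidableEquality A) where

  #distinct : List A → ℕ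
  #distinct xs = length (deduplicate _≟_ xs)

  #distinct-mono : ∀ {xs ys} → xs ⊆ ys → #distinct xs ℕ.≤ #distinct ys
  #distinct-mono {xs} xs⊆ys = Unique-⊆⇒length-≤ (deduplicate-! _≟_ xs)
    (λ p → ∈-deduplicate⁺ _≟_ (xs⊆ys (∈-deduplicate⁻ _≟_ xs p)))

  #distinct-++ : ∀ xs ys → #distinct (xs ++ ys) ℕ.≤ #distinct xs ℕ.+ #distinct ys
  #distinct-++ xs ys = subst (#distinct (xs ++ ys) ℕ.≤_) (length-++ (deduplicate _≟_ xs))
    (Unique-⊆⇒length-≤ (deduplicate-! _≟_ (xs ++ ys)) dedup-++-⊆)
    where
    dedup-++-⊆ : deduplicate _≟_ (xs ++ ys) ⊆ deduplicate _≟_ xs ++ deduplicate _≟_ ys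
    dedup-++-⊆ p = ++⁺ {ws = xs} {ys = ys} (∈-deduplicate⁺ _≟_) (∈-deduplicate⁺ _≟_)
                      (∈-deduplicate⁻ _≟_ (xs ++ ys) p)

module _ {σ : ℕ} where

  d≤d₂ˡ : ∀ k (S T : Str σ) → d k S ℕ.≤ d₂ k S T
  d≤d₂ˡ k S T = #distinct-mono _≟ˢ_ (xs⊆xs++ys (windows k S) (windows k T))

  d≤d₂ʳ : ∀ k (S T : Str σ) → d k T ℕ.≤ d₂ k S T
  d≤d₂ʳ k S T = #distinct-mono _≟ˢ_ (xs⊆ys++xs (windows k T) (windows k S))

  d₂≤d+d : ∀ k (S T : Str σ) → d₂ k S T ℕ.≤ d k S ℕ.+ d k T
  d₂≤d+d k S T = #distinct-++ _≟ˢ_ (windows k S) (windows k T)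

  length≤i⇒d[1+i]≡0 : ∀ i (S : Str σ) → length S ℕ.≤ i → d (suc i) S ≡ 0
  length≤i⇒d[1+i]≡0 i S |S|≤i rewrite ℕ.m≤n⇒m∸n≡0 |S|≤i = refl

toℚᵘ-/ : ∀ m i → toℚᵘ ((+ m) / suc i) ℚᵘ.≃ mkℚᵘ (+ m) i
toℚᵘ-/ m i = ℚ.toℚᵘ-fromℚᵘ (mkℚᵘ (+ m) i)

/-monoˡ-≤ : ∀ {m n} i → m ℕ.≤ n → (+ m) / suc i ℚ.≤ (+ n) / suc i
/-monoˡ-≤ {m} {n} i m≤n = ℚ.toℚᵘ-cancel-≤
  (ℚᵘ.≤-respˡ-≃ (ℚᵘ.≃-sym (toℚᵘ-/ m i)) (ℚᵘ.≤-respʳ-≃ (ℚᵘ.≃-sym (toℚᵘ-/ n i))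
    (*≤* (ℤ.*-monoʳ-≤-nonNeg (+ suc i) (ℤ.+≤+ m≤n)))))

mkℚᵘ-distribʳ-+ : ∀ m n i → mkℚᵘ (+ (m ℕ.+ n)) i ℚᵘ.≃ mkℚᵘ (+ m) i ℚᵘ.+ mkℚᵘ (+ n) i
mkℚᵘ-distribʳ-+ m n i = *≡* (begin
  (+ (m ℕ.+ n)) ℤ.* (+ (k ℕ.* k))      ≡⟨ cong₂ ℤ._*_ (ℤ.pos-+ m n) (ℤ.pos-* k k) ⟩
  (+ m ℤ.+ + n) ℤ.* (+ k ℤ.* + k)      ≡⟨ ℤ.*-assoc (+ m ℤ.+ + n) (+ k) (+ k) ⟨
  (+ m ℤ.+ + n) ℤ.* + k ℤ.* + k        ≡⟨ cong (ℤ._* + k) (ℤ.*-distribʳ-+ (+ k) (+ m) (+ n)) ⟩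
  (+ m ℤ.* + k ℤ.+ + n ℤ.* + k) ℤ.* + k  ∎)
  where
  k : ℕ
  k = suc i
  open ≡-Reasoning

/-distribʳ-+ : ∀ m n i → (+ (m ℕ.+ n)) / suc i ≡ (+ m) / suc i + (+ n) / suc i
/-distribʳ-+ m n i = ℚ.toℚᵘ-injective (begin
  toℚᵘ ((+ (m ℕ.+ n)) / suc i)                      ≈⟨ toℚᵘ-/ (m ℕ.+ n) i ⟩
  mkℚᵘ (+ (m ℕ.+ n)) i                              ≈⟨ mkℚᵘ-distribʳ-+ m n i ⟩
  mkℚᵘ (+ m) i ℚᵘ.+ mkℚᵘ (+ n) i                    ≈⟨ ℚᵘ.+-cong (toℚᵘ-/ m i) (toℚᵘ-/ n i) ⟨
  toℚᵘ ((+ m) / suc i) ℚᵘ.+ toℚᵘ ((+ n) / suc i)    ≈⟨ ℚ.toℚᵘ-homo-+ ((+ m) / suc i) ((+ n) / suc i) ⟨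
  toℚᵘ ((+ m) / suc i + (+ n) / suc i)              ∎)
  where open ℚᵘ.≃-Reasoning

maxℚ-nonNeg : ∀ xs → 0ℚ ℚ.≤ maxℚ xs
maxℚ-nonNeg []       = ℚ.≤-refl
maxℚ-nonNeg (x ∷ xs) = ℚ.p≤q⇒p≤r⊔q x (maxℚ-nonNeg xs)

maxℚ-upper : ∀ {x} xs → x ∈ xs → x ℚ.≤ maxℚ xs
maxℚ-upper (x ∷ xs) (here refl) = ℚ.p≤p⊔q x (maxℚ xs)
maxℚ-upper (x ∷ xs) (there p)   = ℚ.p≤q⇒p≤r⊔q x (maxℚ-upper xs p)

maxℚ-least : ∀ {c} xs → All (ℚ._≤ c) xs → 0ℚ ℚ.≤ c → maxℚ xs ℚ.≤ c
maxℚ-least []       []           0≤c = 0≤c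
maxℚ-least (x ∷ xs) (x≤c ∷ xs≤c) 0≤c = ℚ.⊔-lub x≤c (maxℚ-least xs xs≤c 0≤c)

maxℚ-upTo-upper : ∀ (f : ℕ → ℚ) {n i} → i ℕ.< n → f i ℚ.≤ maxℚ (map f (upTo n))
maxℚ-upTo-upper f {n} i<n = maxℚ-upper (map f (upTo n)) (∈-map⁺ f (∈-upTo⁺ i<n))

maxℚ-upTo-least : ∀ (f : ℕ → ℚ) n {c} → (∀ i → i ℕ.< n → f i ℚ.≤ c) → 0ℚ ℚ.≤ c →
                  maxℚ (map f (upTo n)) ℚ.≤ c
maxℚ-upTo-least f n f≤c = maxℚ-least (map f (upTo n))
  (All.map⁺ (All.applyUpTo⁺₁ (λ i → i) n (λ {i} → f≤c i)))

module _ {σ : ℕ} where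

  δ-nonNeg : ∀ (S : Str σ) → 0ℚ ℚ.≤ δ S
  δ-nonNeg S = maxℚ-nonNeg (map (λ i → (+ d (suc i) S) / suc i) (upTo (length S)))

  δ₂-nonNeg : ∀ (S T : Str σ) → 0ℚ ℚ.≤ δ₂ S T
  δ₂-nonNeg S T =
    maxℚ-nonNeg (map (λ i → (+ d₂ (suc i) S T) / suc i) (upTo (length S ℕ.⊔ length T)))

  d/k≤δ : ∀ (S : Str σ) i → (+ d (suc i) S) / suc i ℚ.≤ δ S
  d/k≤δ S i with i ℕ.<? length S
  ... | yes i<|S| = maxℚ-upTo-upper (λ j → (+ d (suc j) S) / suc j) i<|S|
  ... | no  i≮|S| = subst (ℚ._≤ δ S) d/k≡0 (δ-nonNeg S)
    where
    d/k≡0 : 0ℚ ≡ (+ d (suc i) S) / suc i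
    d/k≡0 = sym (trans (cong (λ m → (+ m) / suc i) (length≤i⇒d[1+i]≡0 i S (ℕ.≮⇒≥ i≮|S|)))
                       (ℚ.0/n≡0 (suc i)))

  δ≤δ₂ : ∀ (U S T : Str σ) → (∀ k → d k U ℕ.≤ d₂ k S T) → length U ℕ.≤ length S ℕ.⊔ length T →
         δ U ℚ.≤ δ₂ S T
  δ≤δ₂ U S T d≤d₂ |U|≤ = maxℚ-upTo-least _ (length U)
    (λ i i<|U| → ℚ.≤-trans (/-monoˡ-≤ i (d≤d₂ (suc i)))
      (maxℚ-upTo-upper (λ j → (+ d₂ (suc j) S T) / suc j) (ℕ.<-≤-trans i<|U| |U|≤)))
    (δ₂-nonNeg S T)

  δ₂≤δ+δ : ∀ (S T : Str σ) → δ₂ S T ℚ.≤ δ S + δ T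
  δ₂≤δ+δ S T = maxℚ-upTo-least _ (length S ℕ.⊔ length T) d₂/k≤δ+δ
    (ℚ.+-mono-≤ (δ-nonNeg S) (δ-nonNeg T))
    where
    d₂/k≤δ+δ : ∀ i → i ℕ.< length S ℕ.⊔ length T → (+ d₂ (suc i) S T) / suc i ℚ.≤ δ S + δ T
    d₂/k≤δ+δ i _ = begin
      (+ d₂ (suc i) S T) / suc i                               ≤⟨ /-monoˡ-≤ i (d₂≤d+d (suc i) S T) ⟩
      (+ (d (suc i) S ℕ.+ d (suc i) T)) / suc i                ≡⟨ /-distribʳ-+ (d (suc i) S) (d (suc i) T) i ⟩
      (+ d (suc i) S) / suc i + (+ d (suc i) T) / suc i        ≤⟨ ℚ.+-mono-≤ (d/k≤δ S i) (d/k≤δ T i) ⟩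
      δ S + δ T                                                ∎
      where open ℚ.≤-Reasoning

lemma2 : (σ : ℕ) (S T : Str σ) →
    ((δ S ⊔ δ T) ≤ δ₂ S T) × (δ₂ S T ≤ δ S + δ T)
lemma2 σ S T =
  ℚ.⊔-lub (δ≤δ₂ S S T (λ k → d≤d₂ˡ k S T) (ℕ.m≤m⊔n (length S) (length T)))
          (δ≤δ₂ T S T (λ k → d≤d₂ʳ k S T) (ℕ.m≤n⊔m (length S) (length T))) ,
  δ₂≤δ+δ S T
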